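{- Let $w$ be a word with an LZ77 factorisation having $m$ factors, stored as described in the context. Procedure Pairing runs in time $O(|w|)$. It modifies the factorisation into a proper LZ77 factorisation of $w$ and returns a pairing of $w$ satisfying, for this new factorisation: (P1) there are no two consecutive positions that are both unpaired; (P2) the first two letters of any factor are paired with each other, and the last two letters of any factor are paired with each other; (P3) if a factor $f=w[i\,..\,i+|f|-1]$ has definition $w[\mathrm{pocz}[i]\,..\,\mathrm{pocz}[i]+|f|-1]$ then the letters of $f$ and of its definition are paired in the same way. Moreover, Pairing creates at most $6m$ new free letters and the returned factorisation has at most $m$ factors.
   Context: Words are indexed from $1$; $w[i\,..\,j]$ is the subword from position $i$ to $j$. An LZ77 factorisation of $w$ is a representation $w=f_1\cdots f_\ell$ where each $f_i$ is either a single letter (a free letter) or a factor: $f_i=w[j\,..\,j+|f_i|-1]$ for some $j\le |f_1\cdots f_{i-1}|$, and $w[j\,..\,j+|f_i|-1]$ is the definition of $f_i$; a factor may have length $1$. A pairing of $w$ assigns to every position a value $\mathrm{pair}[i]\in\{L,R,N\}$ (first of a pair, second of a pair, unpaired), such that $\mathrm{pair}[i]=L$ iff $\mathrm{pair}[i+1]=R$. The factorisation is stored by arrays: $\mathrm{pocz}[i]=j$ if a factor starts at position $i$ and its definition starts at $j$, otherwise $\mathrm{pocz}[i]=\mathrm{false}$; $\mathrm{kon}[i]=\mathrm{true}$ iff $i$ is the last position of a factor. Procedure Pairing: set $\mathrm{pair}[1]=N$, $i=2$. While $i\le |w|$: (A) if $\mathrm{pocz}[i]\ne\mathrm{false}$: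 (a) if $\mathrm{kon}[i]$, set $\mathrm{pocz}[i]=\mathrm{kon}[i]=\mathrm{false}$; (b) else if $\mathrm{pocz}[i]=i-1$, set $\mathrm{pocz}[i+1]=i-1$ and $\mathrm{pocz}[i]=\mathrm{false}$; (c) else if $\mathrm{pair}[\mathrm{pocz}[i]]\ne L$, set $\mathrm{pocz}[i+1]=\mathrm{pocz}[i]+1$ and $\mathrm{pocz}[i]=\mathrm{false}$; (d) else let $j=\mathrm{pocz}[i]$ and repeat {$\mathrm{pair}[i]=\mathrm{pair}[j]$; $i{+}{+}$; $j{+}{+}$} until $\mathrm{kon}[i-1]$; then while $\mathrm{pair}[i-1]\ne R$ do {$i{ - }{ - }$; $\mathrm{kon}[i-1]=\mathrm{true}$; $\mathrm{kon}[i]=\mathrm{false}$; $\mathrm{pair}[i]=N$}. (B) Then, if $\mathrm{pocz}[i]=\mathrm{false}$ (for the current $i$): if $\mathrm{pair}[i-1]=N$ set $\mathrm{pair}[i-1]=L$, $\mathrm{pair}[i]=R$, otherwise set $\mathrm{pair}[i]=N$; and $i{+}{+}$. The output is the array $\mathrm{pair}$ and the modified factorisation given by $\mathrm{pocz},\mathrm{kon}$. -}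

module Defs where

open import Data.Nat using (ℕ; zero; suc; _+_; _*_; _∸_; _≤_; _<_; _≡ᵇ_; _≤ᵇ_)
open import Data.Bool using (Bool; true; false; if_then_else_; not)
open import Data.Maybe using (Maybe; just; nothing)
open import Data.List using (List; []; _∷_; length)
open import Data.List.Membership.Propositional using (_∈_)
open import Data.Product using (Σ; _×_; _,_)
open import Relation.Binary.PropositionalEquality using (_≡_)
open import Relation.Nullary using (¬_)

-- Pair markers: L (first of a pair), R (second of a pair), N (unpaired)

data Pr : Set where
  L R N : Pr

isL isR isN : Pr → Bool
isL L = true
isL _ = false
isR R = true
isR _ = false
isN N = true
isN _ = false

-- Words are lists, positions are 1-indexed.

lookupW : {A : Set} → List A → ℕ → Maybe A
lookupW []       _             = nothing
lookupW (x ∷ xs) zero          = nothing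
lookupW (x ∷ xs) (suc zero)    = just x
lookupW (x ∷ xs) (suc (suc k)) = lookupW xs (suc k)

-- LZ77 factorisations: a list of pieces f_1 ... f_ℓ.
-- 'free' is a free letter; 'fac j len' is a factor of length len whose
-- definition starts at position j.

data Piece : Set where
  free : Piece
  fac  : (src len : ℕ) → Piece

-- ValidFrom w p fs : fs is an LZ77 factorisation of the suffix of w after
-- the first p letters (p = |f_1 ... f_{i-1}|).
ValidFrom : {A : Set} → List A → ℕ → List Piece → Set
ValidFrom w p []               = p ≡ length w
ValidFrom w p (free ∷ fs)      = ValidFrom w (suc p) fs
ValidFrom w p (fac j len ∷ fs) =
  (1 ≤ len) × (1 ≤ j) × (j ≤ p) ×
  (∀ k → k < len → lookupW w (j + k) ≡ lookupW w (suc p + k)) ×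
  ValidFrom w (p + len) fs

IsLZ77 : {A : Set} → List A → List Piece → Set
IsLZ77 w fs = ValidFrom w 0 fs

nFactors : List Piece → ℕ
nFactors []              = 0
nFactors (free ∷ fs)     = nFactors fs
nFactors (fac _ _ ∷ fs)  = suc (nFactors fs)

nFree : List Piece → ℕ
nFree []             = 0
nFree (free ∷ fs)    = suc (nFree fs)
nFree (fac _ _ ∷ fs) = nFree fs

-- occurrences of factors: (start position i, definition start pocz[i], length)
occFrom : ℕ → List Piece → List (ℕ × ℕ × ℕ)
occFrom p []               = []
occFrom p (free ∷ fs)      = occFrom (suc p) fs
occFrom p (fac j len ∷ fs) = (suc p , j , len) ∷ occFrom (p + len) fs

occ : List Piece → List (ℕ × ℕ × ℕ)
occ = occFrom 0

-- Array storage pocz / kon of a factorisation (nothing = false)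

poczFrom : ℕ → List Piece → ℕ → Maybe ℕ
poczFrom p []               q = nothing
poczFrom p (free ∷ fs)      q = poczFrom (suc p) fs q
poczFrom p (fac j len ∷ fs) q = if q ≡ᵇ suc p then just j else poczFrom (p + len) fs q

konFrom : ℕ → List Piece → ℕ → Bool
konFrom p []               q = false
konFrom p (free ∷ fs)      q = konFrom (suc p) fs q
konFrom p (fac j len ∷ fs) q = if q ≡ᵇ p + len then true else konFrom (p + len) fs q

poczOf : List Piece → ℕ → Maybe ℕ
poczOf = poczFrom 0

konOf : List Piece → ℕ → Bool
konOf = konFrom 0

Stores : ℕ → List Piece → (ℕ → Maybe ℕ) → (ℕ → Bool) → Set
Stores n fs pocz kon =
  ∀ q → 1 ≤ q → q ≤ n → (pocz q ≡ poczOf fs q) × (kon q ≡ konOf fs q)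

IsPairing : ℕ → (ℕ → Pr) → Set
IsPairing n pair =
  (∀ i → 1 ≤ i → i ≤ n → pair i ≡ L → (suc i ≤ n) × (pair (suc i) ≡ R)) ×
  (∀ i → 1 ≤ i → suc i ≤ n → pair (suc i) ≡ R → pair i ≡ L) ×
  (∀ i → 1 ≤ i → i ≤ n → pair i ≡ R → 2 ≤ i)

P1 : ℕ → (ℕ → Pr) → Set
P1 n pair = ∀ i → 1 ≤ i → suc i ≤ n → ¬ ((pair i ≡ N) × (pair (suc i) ≡ N))

P2 : List Piece → (ℕ → Pr) → Set
P2 fs pair = ∀ i j len → (i , j , len) ∈ occ fs →
  (pair i ≡ L) × (pair (suc i) ≡ R) ×
  (pair (i + len ∸ 2) ≡ L) × (pair (i + len ∸ 1) ≡ R)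

P3 : List Piece → (ℕ → Pr) → Set
P3 fs pair = ∀ i j len → (i , j , len) ∈ occ fs →
  ∀ k → k < len → pair (i + k) ≡ pair (j + k)

-- Procedure Pairing as a small-step machine; each step is O(1) work,
-- so the number of steps measures the running time.

set : {B : Set} → (ℕ → B) → ℕ → B → ℕ → B
set f i v q = if q ≡ᵇ i then v else f q

data PC : Set where
  loop stepA copy back stepB done : PC

record St : Set where
  constructor st
  field
    pc   : PC
    i    : ℕ
    j    : ℕ
    pocz : ℕ → Maybe ℕ
    kon  : ℕ → Bool
    pair : ℕ → Pr

isDone : St → Bool
isDone (st done _ _ _ _ _) = true
isDone _                   = false

step : ℕ → St → St
step n (st loop i j p k pr) =
  if i ≤ᵇ n then st stepA i j p k pr else st done i j p k pr
step n (st stepA i j p k pr) with p i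
... | nothing = st stepB i j p k pr
... | just d =
  if k i
  then st stepB i j (set p i nothing) (set k i false) pr                       -- (a)
  else if d ≡ᵇ i ∸ 1
  then st stepB i j (set (set p (suc i) (just (i ∸ 1))) i nothing) k pr        -- (b)
  else if not (isL (pr d))
  then st stepB i j (set (set p (suc i) (just (suc d))) i nothing) k pr        -- (c)
  else st copy i d p k pr                                                      -- (d)
step n (st copy i j p k pr) =
  st (if k i then back else copy) (suc i) (suc j) p k (set pr i (pr j))
step n (st back i j p k pr) =
  if isR (pr (i ∸ 1))
  then st stepB i j p k pr
  else st back (i ∸ 1) j p (set (set k (i ∸ 1 ∸ 1) true) (i ∸ 1) false) (set pr (i ∸ 1) N)
step n (st stepB i j p k pr) with p i
... | nothing =
  st loop (suc i) j p k
    (if isN (pr (i ∸ 1)) then set (set pr (i ∸ 1) L) i R else set pr i N)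
... | just _ = st loop i j p k pr
step n (st done i j p k pr) = st done i j p k pr

initSt : List Piece → St
initSt fs = st loop 2 0 (poczOf fs) (konOf fs) (λ _ → N)

run : ℕ → ℕ → St → Maybe St
run n zero    s = if isDone s then just s else nothing
run n (suc t) s = if isDone s then just s else run n t (step n s)

-- The procedure is followed step by step with an invariant at the top of its main loop: the
-- arrays store a valid factorisation, the scanned prefix 1 .. c is exactly covered by its first
-- pieces, every two neighbouring letters of the prefix are paired as LR, RL, RN or NL (which gives
-- (P1) and the pairing axioms), letter c is not L, and the factors of the prefix satisfy (P2) and
-- (P3).  Cases (a)-(c) turn the next letter into a free letter and shorten the factor by one from
-- the left; in case (d) the pairing of the definition is copied, which is consistent because the
-- definition begins with L and the previous letter is not L, and the factor is then cut back to
-- end on an R, which is at most two letters away.  Free letters are paid for by credits attached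
-- to the factors, and each scanned position costs at most five steps.

module Submission where

open import Defs
open import Data.Nat
open import Data.Nat.Properties
open import Data.Nat.Induction using (<-rec)
open import Data.Nat.Tactic.RingSolver using (solve-∀)
open import Data.Bool using (Bool; true; false; if_then_else_; T)
open import Data.Unit using (tt)
open import Data.Maybe using (Maybe; just; nothing)
open import Data.List using (List; []; _∷_; length; _++_)
open import Data.List.Properties using (++-assoc; ++-identityʳ)
open import Data.List.Relation.Unary.All as All using (All; []; _∷_)
open import Data.List.Relation.Unary.All.Properties using (++⁺)
open import Data.Product using (Σ; _×_; _,_; proj₁; proj₂)
open import Data.Sum using (_⊎_; inj₁; inj₂; [_,_]′)
open import Data.Empty using (⊥; ⊥-elim)
open import Relation.Binary.PropositionalEquality
open import Relation.Nullary using (Dec; yes; no)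
open import Function using (_∘′_; case_of_)

≡ᵇ-refl : ∀ i → (i ≡ᵇ i) ≡ true
≡ᵇ-refl zero    = refl
≡ᵇ-refl (suc i) = ≡ᵇ-refl i

≢⇒≡ᵇ≡false : ∀ q i → q ≢ i → (q ≡ᵇ i) ≡ false
≢⇒≡ᵇ≡false zero    zero    q≢i = ⊥-elim (q≢i refl)
≢⇒≡ᵇ≡false zero    (suc i) _   = refl
≢⇒≡ᵇ≡false (suc q) zero    _   = refl
≢⇒≡ᵇ≡false (suc q) (suc i) q≢i = ≢⇒≡ᵇ≡false q i (q≢i ∘′ cong suc)

≤⇒≤ᵇ≡true : ∀ {a b} → a ≤ b → (a ≤ᵇ b) ≡ true
≤⇒≤ᵇ≡true {a} {b} a≤b with a ≤ᵇ b | ≤⇒≤ᵇ a≤b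
... | true | _ = refl

>⇒≤ᵇ≡false : ∀ {a b} → b < a → (a ≤ᵇ b) ≡ false
>⇒≤ᵇ≡false {a} {b} b<a with a ≤ᵇ b in eq
... | false = refl
... | true  = ⊥-elim (<⇒≱ b<a (≤ᵇ⇒≤ a b (subst T (sym eq) tt)))

if-true : ∀ {B : Set} {b : Bool} {x y : B} → b ≡ true → (if b then x else y) ≡ x
if-true refl = refl

if-false : ∀ {B : Set} {b : Bool} {x y : B} → b ≡ false → (if b then x else y) ≡ y
if-false refl = refl

set-≡ : ∀ {B : Set} (f : ℕ → B) i v → set f i v i ≡ v
set-≡ f i v = if-true (≡ᵇ-refl i)

set-≢ : ∀ {B : Set} (f : ℕ → B) i v q → q ≢ i → set f i v q ≡ f q
set-≢ f i v q q≢i = if-false (≢⇒≡ᵇ≡false q i q≢i)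

AgreeUpTo : ∀ {B : Set} → ℕ → (ℕ → B) → (ℕ → B) → Set
AgreeUpTo m f g = ∀ q → q ≤ m → f q ≡ g q

set-agree : ∀ {B : Set} (f : ℕ → B) {m i} v → m < i → AgreeUpTo m (set f i v) f
set-agree f {i = i} v m<i q q≤m = set-≢ f i v q (<⇒≢ (≤-<-trans q≤m m<i))

endFrom : ℕ → List Piece → ℕ
endFrom p []               = p
endFrom p (free ∷ fs)      = endFrom (suc p) fs
endFrom p (fac _ len ∷ fs) = endFrom (p + len) fs

≤-endFrom : ∀ p fs → p ≤ endFrom p fs
≤-endFrom p []               = ≤-refl
≤-endFrom p (free ∷ fs)      = ≤-trans (n≤1+n p) (≤-endFrom (suc p) fs)
≤-endFrom p (fac _ len ∷ fs) = ≤-trans (m≤m+n p len) (≤-endFrom (p + len) fs)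

endFrom-++ : ∀ p a b → endFrom p (a ++ b) ≡ endFrom (endFrom p a) b
endFrom-++ p []               b = refl
endFrom-++ p (free ∷ a)       b = endFrom-++ (suc p) a b
endFrom-++ p (fac _ len ∷ a)  b = endFrom-++ (p + len) a b

occFrom-++ : ∀ p a b → occFrom p (a ++ b) ≡ occFrom p a ++ occFrom (endFrom p a) b
occFrom-++ p []              b = refl
occFrom-++ p (free ∷ a)      b = occFrom-++ (suc p) a b
occFrom-++ p (fac j len ∷ a) b = cong ((suc p , j , len) ∷_) (occFrom-++ (p + len) a b)

nFree-++ : ∀ a b → nFree (a ++ b) ≡ nFree a + nFree b
nFree-++ []            b = refl
nFree-++ (free ∷ a)    b = cong suc (nFree-++ a b)
nFree-++ (fac _ _ ∷ a) b = nFree-++ a b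

nFactors-++ : ∀ a b → nFactors (a ++ b) ≡ nFactors a + nFactors b
nFactors-++ []            b = refl
nFactors-++ (free ∷ a)    b = nFactors-++ a b
nFactors-++ (fac _ _ ∷ a) b = cong suc (nFactors-++ a b)

poczFrom-≤ : ∀ p fs q → q ≤ p → poczFrom p fs q ≡ nothing
poczFrom-≤ p []               q q≤p = refl
poczFrom-≤ p (free ∷ fs)      q q≤p = poczFrom-≤ (suc p) fs q (m≤n⇒m≤1+n q≤p)
poczFrom-≤ p (fac j len ∷ fs) q q≤p =
  trans (if-false (≢⇒≡ᵇ≡false q (suc p) (<⇒≢ (s≤s q≤p))))
        (poczFrom-≤ (p + len) fs q (≤-trans q≤p (m≤m+n p len)))

poczFrom-++-≤ : ∀ p a b b' q → q ≤ endFrom p a → poczFrom p (a ++ b) q ≡ poczFrom p (a ++ b') q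
poczFrom-++-≤ p []              b b' q q≤ = trans (poczFrom-≤ p b q q≤) (sym (poczFrom-≤ p b' q q≤))
poczFrom-++-≤ p (free ∷ a)      b b' q q≤ = poczFrom-++-≤ (suc p) a b b' q q≤
poczFrom-++-≤ p (fac j len ∷ a) b b' q q≤ =
  cong (if q ≡ᵇ suc p then just j else_) (poczFrom-++-≤ (p + len) a b b' q q≤)

konFrom-++-> : ∀ p a b q → endFrom p a < q → konFrom p (a ++ b) q ≡ konFrom (endFrom p a) b q
konFrom-++-> p []              b q lt = refl
konFrom-++-> p (free ∷ a)      b q lt = konFrom-++-> (suc p) a b q lt
konFrom-++-> p (fac j len ∷ a) b q lt =
  trans (if-false (≢⇒≡ᵇ≡false q (p + len) (>⇒≢ (≤-<-trans (≤-endFrom (p + len) a) lt))))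
        (konFrom-++-> (p + len) a b q lt)

module _ {A : Set} (w : List A) where

  copies-shift : ∀ {d c l} → (∀ x → x < suc (suc l) → lookupW w (d + x) ≡ lookupW w (suc c + x)) →
                 ∀ x → x < suc l → lookupW w (suc d + x) ≡ lookupW w (suc (suc c) + x)
  copies-shift {d} {c} same x x< =
    trans (cong (lookupW w) (sym (+-suc d x))) (trans (same (suc x) (s≤s x<)) (cong (lookupW w) (+-suc (suc c) x)))

  copies-selfOverlap : ∀ {c l} → (∀ x → x < suc (suc l) → lookupW w (c + x) ≡ lookupW w (suc c + x)) →
                       ∀ x → x < suc l → lookupW w (c + x) ≡ lookupW w (suc (suc c) + x)
  copies-selfOverlap same x x< = trans (same x (m<n⇒m<1+n x<)) (copies-shift same x x<)

  ValidFrom⇒endFrom : ∀ p fs → ValidFrom w p fs → endFrom p fs ≡ length w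
  ValidFrom⇒endFrom p []               v = v
  ValidFrom⇒endFrom p (free ∷ fs)      v = ValidFrom⇒endFrom (suc p) fs v
  ValidFrom⇒endFrom p (fac j len ∷ fs) (_ , _ , _ , _ , v) = ValidFrom⇒endFrom (p + len) fs v

  ValidFrom-++⁻ʳ : ∀ p a b → ValidFrom w p (a ++ b) → ValidFrom w (endFrom p a) b
  ValidFrom-++⁻ʳ p []              b v = v
  ValidFrom-++⁻ʳ p (free ∷ a)      b v = ValidFrom-++⁻ʳ (suc p) a b v
  ValidFrom-++⁻ʳ p (fac j len ∷ a) b (_ , _ , _ , _ , v) = ValidFrom-++⁻ʳ (p + len) a b v

  ValidFrom-++-replace : ∀ p a b b' → (ValidFrom w (endFrom p a) b → ValidFrom w (endFrom p a) b') →
                         ValidFrom w p (a ++ b) → ValidFrom w p (a ++ b')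
  ValidFrom-++-replace p []              b b' f v = f v
  ValidFrom-++-replace p (free ∷ a)      b b' f v = ValidFrom-++-replace (suc p) a b b' f v
  ValidFrom-++-replace p (fac j len ∷ a) b b' f (l1 , j1 , j≤ , copies , v) =
    l1 , j1 , j≤ , copies , ValidFrom-++-replace (p + len) a b b' f v

  <-endFrom : ∀ p x fs → ValidFrom w p (x ∷ fs) → p < endFrom p (x ∷ fs)
  <-endFrom p free        fs v          = ≤-endFrom (suc p) fs
  <-endFrom p (fac j len) fs (l1 , _)   = <-≤-trans (m<m+n p l1) (≤-endFrom (p + len) fs)

  konFrom-≤ : ∀ p fs q → ValidFrom w p fs → q ≤ p → konFrom p fs q ≡ false
  konFrom-≤ p []               q v q≤p = refl
  konFrom-≤ p (free ∷ fs)      q v q≤p = konFrom-≤ (suc p) fs q v (m≤n⇒m≤1+n q≤p)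
  konFrom-≤ p (fac j len ∷ fs) q (l1 , _ , _ , _ , v) q≤p =
    trans (if-false (≢⇒≡ᵇ≡false q (p + len) (<⇒≢ (≤-<-trans q≤p (m<m+n p l1)))))
          (konFrom-≤ (p + len) fs q v (≤-trans q≤p (m≤m+n p len)))

  konFrom-++-≤ : ∀ p a b b' q → q ≤ endFrom p a →
                 ValidFrom w (endFrom p a) b → ValidFrom w (endFrom p a) b' →
                 konFrom p (a ++ b) q ≡ konFrom p (a ++ b') q
  konFrom-++-≤ p []              b b' q q≤ v v' = trans (konFrom-≤ p b q v q≤) (sym (konFrom-≤ p b' q v' q≤))
  konFrom-++-≤ p (free ∷ a)      b b' q q≤ v v' = konFrom-++-≤ (suc p) a b b' q q≤ v v'
  konFrom-++-≤ p (fac j len ∷ a) b b' q q≤ v v' =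
    cong (if q ≡ᵇ p + len then true else_) (konFrom-++-≤ (p + len) a b b' q q≤ v v')

  poczFrom-++-> : ∀ p a b q → ValidFrom w p (a ++ b) → endFrom p a < q →
                  poczFrom p (a ++ b) q ≡ poczFrom (endFrom p a) b q
  poczFrom-++-> p []              b q v lt = refl
  poczFrom-++-> p (free ∷ a)      b q v lt = poczFrom-++-> (suc p) a b q v lt
  poczFrom-++-> p (fac j len ∷ a) b q (l1 , _ , _ , _ , v) lt =
    trans (if-false (≢⇒≡ᵇ≡false q (suc p)
            (>⇒≢ (≤-<-trans (m<m+n p l1) (≤-<-trans (≤-endFrom (p + len) a) lt)))))
          (poczFrom-++-> (p + len) a b q v lt)

≢L⇒N⊎R : ∀ {x} → x ≢ L → x ≡ N ⊎ x ≡ R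
≢L⇒N⊎R {L} x≢L = ⊥-elim (x≢L refl)
≢L⇒N⊎R {N} _   = inj₁ refl
≢L⇒N⊎R {R} _   = inj₂ refl

≢L⇒isL≡false : ∀ {x} → x ≢ L → isL x ≡ false
≢L⇒isL≡false {L} x≢L = ⊥-elim (x≢L refl)
≢L⇒isL≡false {N} _   = refl
≢L⇒isL≡false {R} _   = refl

≢R⇒isR≡false : ∀ {x} → x ≢ R → isR x ≡ false
≢R⇒isR≡false {R} x≢R = ⊥-elim (x≢R refl)
≢R⇒isR≡false {L} _   = refl
≢R⇒isR≡false {N} _   = refl

_≟L : ∀ x → Dec (x ≡ L)
L ≟L = yes refl
N ≟L = no (λ ())
R ≟L = no (λ ())

_≟R : ∀ x → Dec (x ≡ R)
L ≟R = no (λ ())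
N ≟R = no (λ ())
R ≟R = yes refl

-- The pairs of neighbouring letters allowed by the pairing axioms and (P1).
data Adjacent : Pr → Pr → Set where
  LR : Adjacent L R
  RL : Adjacent R L
  RN : Adjacent R N
  NL : Adjacent N L

Adjacent-toL : ∀ {x} → x ≢ L → Adjacent x L
Adjacent-toL {L} x≢L = ⊥-elim (x≢L refl)
Adjacent-toL {R} _   = RL
Adjacent-toL {N} _   = NL

Adjacent-fromL : ∀ {y} → Adjacent L y → y ≡ R
Adjacent-fromL LR = refl

Adjacent-toR : ∀ {x} → Adjacent x R → x ≡ L
Adjacent-toR LR = refl

Adjacent-toN : ∀ {x} → Adjacent x N → x ≡ R
Adjacent-toN RN = refl

record PairedUpTo (m : ℕ) (pr : ℕ → Pr) : Set where
  field
    startNotR : pr 1 ≢ R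
    adjacent  : ∀ q → 1 ≤ q → suc q ≤ m → Adjacent (pr q) (pr (suc q))

PairedUpTo-agree : ∀ {m m' pr pr'} → 1 ≤ m' → m' ≤ m → AgreeUpTo m' pr' pr →
                   PairedUpTo m pr → PairedUpTo m' pr'
PairedUpTo-agree {pr = pr} {pr'} 1≤m' m'≤m ag P = record
  { startNotR = λ e → PairedUpTo.startNotR P (trans (sym (ag 1 1≤m')) e)
  ; adjacent  = λ q q1 q< → subst₂ Adjacent (sym (ag q (<⇒≤ q<))) (sym (ag (suc q) q<))
                              (PairedUpTo.adjacent P q q1 (≤-trans q< m'≤m))
  }

PairedUpTo-suc : ∀ {m pr} → 1 ≤ m → PairedUpTo m pr → Adjacent (pr m) (pr (suc m)) → PairedUpTo (suc m) pr
PairedUpTo-suc {m} {pr} 1≤m P adj = record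
  { startNotR = PairedUpTo.startNotR P
  ; adjacent  = λ q q1 q< → [ (λ q<m → PairedUpTo.adjacent P q q1 q<m)
                            , (λ { refl → adj }) ]′ (m≤n⇒m<n∨m≡n (≤-pred q<))
  }

PairedUpTo-N→L : ∀ {c pr pr'} → 1 ≤ c → PairedUpTo c pr → pr c ≡ N →
                 (∀ q → q < c → pr' q ≡ pr q) → pr' c ≡ L → PairedUpTo c pr'
PairedUpTo-N→L {c} {pr} {pr'} 1≤c P prc ag pr'c = record { startNotR = start ; adjacent = adj }
  where
  start : pr' 1 ≢ R
  start with m≤n⇒m<n∨m≡n 1≤c
  ... | inj₁ 1<c = λ e → PairedUpTo.startNotR P (trans (sym (ag 1 1<c)) e)
  ... | inj₂ refl = λ e → case trans (sym pr'c) e of λ ()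
  adj : ∀ q → 1 ≤ q → suc q ≤ c → Adjacent (pr' q) (pr' (suc q))
  adj q q1 q< with m≤n⇒m<n∨m≡n q< | PairedUpTo.adjacent P q q1 q<
  ... | inj₁ sq<c | a = subst₂ Adjacent (sym (ag q (<-trans (n<1+n q) sq<c))) (sym (ag (suc q) sq<c)) a
  ... | inj₂ refl | a =
    subst₂ Adjacent (sym (trans (ag q (n<1+n q)) (Adjacent-toN (subst (Adjacent (pr q)) prc a)))) (sym pr'c) RL

-- Step (B) for a free letter at position suc c.
pairFree : (ℕ → Pr) → ℕ → ℕ → Pr
pairFree pr c = if isN (pr c) then set (set pr c L) (suc c) R else set pr (suc c) N

pairFree-< : ∀ pr c q → q < c → pairFree pr c q ≡ pr q
pairFree-< pr c q q<c with isN (pr c)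
... | true  = trans (set-≢ (set pr c L) (suc c) R q (<⇒≢ (<-trans q<c (n<1+n c)))) (set-≢ pr c L q (<⇒≢ q<c))
... | false = set-≢ pr (suc c) N q (<⇒≢ (<-trans q<c (n<1+n c)))

pairFree-N : ∀ pr c → pr c ≡ N → pairFree pr c c ≡ L × pairFree pr c (suc c) ≡ R
pairFree-N pr c e rewrite e =
  trans (set-≢ (set pr c L) (suc c) R c (<⇒≢ (n<1+n c))) (set-≡ pr c L) , set-≡ (set pr c L) (suc c) R

pairFree-R : ∀ pr c → pr c ≡ R → pairFree pr c c ≡ R × pairFree pr c (suc c) ≡ N
pairFree-R pr c e rewrite e = trans (set-≢ pr (suc c) N c (<⇒≢ (n<1+n c))) e , set-≡ pr (suc c) N

pairFree-R-agree : ∀ pr c → pr c ≡ R → AgreeUpTo c (pairFree pr c) pr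
pairFree-R-agree pr c prc q q≤c =
  [ pairFree-< pr c q , (λ { refl → trans (proj₁ (pairFree-R pr c prc)) (sym prc) }) ]′ (m≤n⇒m<n∨m≡n q≤c)

pairFree-PairedUpTo : ∀ {c pr} → 1 ≤ c → PairedUpTo c pr → pr c ≢ L →
                      PairedUpTo (suc c) (pairFree pr c) × pairFree pr c (suc c) ≢ L
pairFree-PairedUpTo {c} {pr} 1≤c P prc≢L with ≢L⇒N⊎R prc≢L
... | inj₁ prc =
  PairedUpTo-suc 1≤c (PairedUpTo-N→L 1≤c P prc (pairFree-< pr c) c↦L) (subst₂ Adjacent (sym c↦L) (sym c+1↦R) LR)
        , λ e → case trans (sym e) c+1↦R of λ ()
  where
  c↦L = proj₁ (pairFree-N pr c prc)
  c+1↦R = proj₂ (pairFree-N pr c prc)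
... | inj₂ prc =
  PairedUpTo-suc 1≤c (PairedUpTo-agree 1≤c ≤-refl agree P) (subst₂ Adjacent (sym c↦R) (sym c+1↦N) RN)
        , λ e → case trans (sym e) c+1↦N of λ ()
  where
  c↦R = proj₁ (pairFree-R pr c prc)
  c+1↦N = proj₂ (pairFree-R pr c prc)
  agree = pairFree-R-agree pr c prc

-- (P2) and (P3) for an occurrence (s , d , len) inside 1 .. c; the other two letters of (P2)
-- follow by adjacency.
data FactorPaired (c : ℕ) (pr : ℕ → Pr) : ℕ × ℕ × ℕ → Set where
  paired : ∀ {s d l} → d < s → suc (s + l) ≤ c → pr s ≡ L → pr (suc (s + l)) ≡ R →
           (∀ k → k < suc (suc l) → pr (s + k) ≡ pr (d + k)) → FactorPaired c pr (s , d , suc (suc l))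

-- A paired factor ends on an R, so position c may change unless it holds an R.
FactorPaired-stable : ∀ {c c' pr pr'} → c ≤ c' → (∀ q → q < c → pr' q ≡ pr q) → (pr c ≡ R → pr' c ≡ R) →
                      ∀ {o} → FactorPaired c pr o → FactorPaired c' pr' o
FactorPaired-stable {c} {c'} {pr} {pr'} c≤c' ag agR (paired {s} {d} {l} d<s end≤c first last copies) =
  paired d<s (≤-trans end≤c c≤c')
    (subst (λ q → pr' q ≡ L) (+-identityʳ s)
      (trans (inFactor 0 (s≤s z≤n)) (subst (λ q → pr q ≡ L) (sym (+-identityʳ s)) first)))
    (subst (λ q → pr' q ≡ R) (+-suc s l)
      (trans (inFactor (suc l) ≤-refl) (subst (λ q → pr q ≡ R) (sym (+-suc s l)) last)))
    (λ k k< → trans (inFactor k k<)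
                (trans (copies k k<) (sym (ag (d + k) (<-≤-trans (+-monoˡ-< k d<s) (inFactor-≤ k k<))))))
  where
  inFactor-≤ : ∀ k → k < suc (suc l) → s + k ≤ c
  inFactor-≤ k k< = ≤-trans (+-monoʳ-≤ s (≤-pred k<)) (subst (_≤ c) (sym (+-suc s l)) end≤c)
  inFactor : ∀ k → k < suc (suc l) → pr' (s + k) ≡ pr (s + k)
  inFactor k k< with m≤n⇒m<n∨m≡n (inFactor-≤ k k<)
  ... | inj₁ lt = ag (s + k) lt
  ... | inj₂ eq = subst (λ q → pr' q ≡ pr q) (sym eq) (trans (agR prc) (sym prc))
    where
    atEnd : c ≡ suc (s + l)
    atEnd = ≤-antisym (subst (_≤ suc (s + l)) eq (subst (s + k ≤_) (+-suc s l) (+-monoʳ-≤ s (≤-pred k<)))) end≤c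
    prc : pr c ≡ R
    prc = subst (λ q → pr q ≡ R) (sym atEnd) last

FactorPaired⇒P2 : ∀ {c pr i j len} → PairedUpTo c pr → FactorPaired c pr (i , j , len) →
  (pr i ≡ L) × (pr (suc i) ≡ R) × (pr (i + len ∸ 2) ≡ L) × (pr (i + len ∸ 1) ≡ R)
FactorPaired⇒P2 {c} {pr} P (paired {s} {d} {l} d<s end≤c first last _) =
  first ,
  Adjacent-fromL (subst (λ x → Adjacent x (pr (suc s))) first (adjacent s 1≤s (≤-trans (s≤s (m≤m+n s l)) end≤c))) ,
  subst (λ x → pr x ≡ L) (sym (cong (_∸ 2) end≡))
    (Adjacent-toR (subst (Adjacent (pr (s + l))) last (adjacent (s + l) (≤-trans 1≤s (m≤m+n s l)) end≤c))) ,
  subst (λ x → pr x ≡ R) (sym (cong (_∸ 1) end≡)) last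
  where
  open PairedUpTo P
  1≤s = ≤-trans (s≤s z≤n) d<s
  end≡ : s + suc (suc l) ≡ suc (suc (s + l))
  end≡ = trans (+-suc s (suc l)) (cong suc (+-suc s l))

FactorPaired⇒P3 : ∀ {c pr i j len} → FactorPaired c pr (i , j , len) → ∀ k → k < len → pr (i + k) ≡ pr (j + k)
FactorPaired⇒P3 (paired _ _ _ _ copies) = copies

PairedUpTo⇒IsPairing : ∀ {m pr} → PairedUpTo m pr → pr m ≢ L → IsPairing m pr
PairedUpTo⇒IsPairing {m} {pr} P notL = LthenR , RafterL , R≥2
  where
  open PairedUpTo P
  LthenR : ∀ i → 1 ≤ i → i ≤ m → pr i ≡ L → (suc i ≤ m) × (pr (suc i) ≡ R)
  LthenR i 1≤i i≤m e with m≤n⇒m<n∨m≡n i≤m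
  ... | inj₁ i<m  = i<m , Adjacent-fromL (subst (λ x → Adjacent x (pr (suc i))) e (adjacent i 1≤i i<m))
  ... | inj₂ refl = ⊥-elim (notL e)
  RafterL : ∀ i → 1 ≤ i → suc i ≤ m → pr (suc i) ≡ R → pr i ≡ L
  RafterL i 1≤i i<m e = Adjacent-toR (subst (Adjacent (pr i)) e (adjacent i 1≤i i<m))
  R≥2 : ∀ i → 1 ≤ i → i ≤ m → pr i ≡ R → 2 ≤ i
  R≥2 (suc zero)    _ _ e = ⊥-elim (startNotR e)
  R≥2 (suc (suc i)) _ _ _ = s≤s (s≤s z≤n)

PairedUpTo⇒P1 : ∀ {m pr} → PairedUpTo m pr → P1 m pr
PairedUpTo⇒P1 P i 1≤i i<m (e , e') with subst₂ Adjacent e e' (PairedUpTo.adjacent P i 1≤i i<m)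
... | ()

Step : ℕ → St → St → Set
Step n s s' = isDone s ≡ false × step n s ≡ s'

data Steps (n : ℕ) : ℕ → St → St → Set where
  []  : ∀ {s} → Steps n 0 s s
  _∷_ : ∀ {t s s' s''} → Step n s s' → Steps n t s' s'' → Steps n (suc t) s s''

Steps-++ : ∀ {n a b s s' s''} → Steps n a s s' → Steps n b s' s'' → Steps n (a + b) s s''
Steps-++ []       q = q
Steps-++ (x ∷ xs) q = x ∷ Steps-++ xs q

Steps-run : ∀ {n t s s'} T → Steps n t s s' → run n (t + T) s ≡ run n T s'
Steps-run T [] = refl
Steps-run T ((running , refl) ∷ xs) rewrite running = Steps-run T xs

run-done : ∀ n T s → isDone s ≡ true → run n T s ≡ just s
run-done n zero    s e rewrite e = refl
run-done n (suc T) s e rewrite e = refl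

run-mono : ∀ n {T T'} s {f} → T ≤ T' → run n T s ≡ just f → run n T' s ≡ just f
run-mono n {zero}  {T'}    s z≤n h with isDone s in eq
... | true = trans (run-done n T' s eq) h
run-mono n {suc T} {suc T'} s (s≤s T≤T') h with isDone s
... | true  = h
... | false = run-mono n (step n s) T≤T' h

-- How far back from a letter the nearest R is, in a pairing satisfying (P1).
stepsBackToR : Pr → ℕ
stepsBackToR R = 0
stepsBackToR N = 1
stepsBackToR L = 2

Adjacent-stepsBackToR : ∀ {x y} → Adjacent x y → y ≢ R → stepsBackToR x < stepsBackToR y
Adjacent-stepsBackToR LR y≢R = ⊥-elim (y≢R refl)
Adjacent-stepsBackToR RL _   = s≤s z≤n
Adjacent-stepsBackToR RN _   = s≤s z≤n
Adjacent-stepsBackToR NL _   = s≤s (s≤s z≤n)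

stepsBackToR≤2 : ∀ x → stepsBackToR x ≤ 2
stepsBackToR≤2 R = z≤n
stepsBackToR≤2 N = s≤s z≤n
stepsBackToR≤2 L = ≤-refl

creditPr : Pr → ℕ
creditPr L = 2
creditPr N = 3
creditPr R = 4

-- Cases (b) and (c) free one letter and strictly lower the credit of the shifted factor,
-- case (d) frees at most two letters and a factor in case (a) has credit at least two;
-- a factor not yet reached holds six credits.
credit : ℕ → ℕ → (ℕ → Pr) → ℕ
credit c d pr = if d ≡ᵇ c then 5 else creditPr (pr d)

credit-L : ∀ {c d pr} → d ≢ c → pr d ≡ L → credit c d pr ≡ 2
credit-L {c} {d} d≢c prd rewrite ≢⇒≡ᵇ≡false d c d≢c | prd = refl

credits : ℕ → (ℕ → Pr) → List Piece → ℕ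
credits c pr []            = 0
credits c pr (free ∷ t)    = 6 * nFactors t
credits c pr (fac d _ ∷ t) = credit c d pr + 6 * nFactors t

creditPr≤4 : ∀ x → creditPr x ≤ 4
creditPr≤4 L = s≤s (s≤s z≤n)
creditPr≤4 N = s≤s (s≤s (s≤s z≤n))
creditPr≤4 R = ≤-refl

credit≤5 : ∀ c d pr → credit c d pr ≤ 5
credit≤5 c d pr with d ≡ᵇ c
... | true  = ≤-refl
... | false = ≤-trans (creditPr≤4 (pr d)) (n≤1+n 4)

2≤credit : ∀ c d pr → 2 ≤ credit c d pr
2≤credit c d pr with d ≡ᵇ c
... | true = s≤s (s≤s z≤n)
... | false with pr d
... | L = ≤-refl
... | N = s≤s (s≤s z≤n)
... | R = s≤s (s≤s z≤n)

creditPr-Adjacent : ∀ {x y} → Adjacent x y → x ≢ L → suc (creditPr y) ≤ creditPr x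
creditPr-Adjacent LR x≢L = ⊥-elim (x≢L refl)
creditPr-Adjacent RL _   = s≤s (s≤s (s≤s z≤n))
creditPr-Adjacent RN _   = ≤-refl
creditPr-Adjacent NL _   = ≤-refl

credit-selfOverlap : ∀ c pr pr' → suc (credit (suc c) c pr') ≤ credit c c pr
credit-selfOverlap c pr pr' rewrite ≡ᵇ-refl c | ≢⇒≡ᵇ≡false c (suc c) (<⇒≢ (n<1+n c)) =
  s≤s (creditPr≤4 (pr' c))

credit-shift : ∀ {c d pr pr'} → d < c → Adjacent (pr d) (pr' (suc d)) → pr d ≢ L →
               suc (credit (suc c) (suc d) pr') ≤ credit c d pr
credit-shift {c} {d} d<c adj prd≢L rewrite ≢⇒≡ᵇ≡false d c (<⇒≢ d<c) = creditPr-Adjacent adj prd≢L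

credits≤ : ∀ c pr r → credits c pr r ≤ 6 * nFactors r
credits≤ c pr []            = z≤n
credits≤ c pr (free ∷ t)    = ≤-refl
credits≤ c pr (fac d l ∷ t) = subst (credit c d pr + 6 * nFactors t ≤_) (sym (*-suc 6 (nFactors t)))
  (+-monoˡ-≤ (6 * nFactors t) (≤-trans (credit≤5 c d pr) (n≤1+n 5)))


-- Cases (a) to (d) of step (A) are stepA-unit, stepA-selfOverlap, stepA-shift and stepA-copy.
module Transitions (n : ℕ) {j : ℕ} {p : ℕ → Maybe ℕ} {k : ℕ → Bool} {pr : ℕ → Pr} where

  loop→stepA : ∀ {c} → c < n → Step n (st loop (suc c) j p k pr) (st stepA (suc c) j p k pr)
  loop→stepA c<n rewrite ≤⇒≤ᵇ≡true c<n = refl , refl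

  loop→done : ∀ {i} → n < i → Step n (st loop i j p k pr) (st done i j p k pr)
  loop→done n<i rewrite >⇒≤ᵇ≡false n<i = refl , refl

  stepA-free : ∀ {i} → p i ≡ nothing → Step n (st stepA i j p k pr) (st stepB i j p k pr)
  stepA-free e rewrite e = refl , refl

  stepA-unit : ∀ {i d} → p i ≡ just d → k i ≡ true →
    Step n (st stepA i j p k pr) (st stepB i j (set p i nothing) (set k i false) pr)
  stepA-unit e e' rewrite e | e' = refl , refl

  stepA-selfOverlap : ∀ {c} → p (suc c) ≡ just c → k (suc c) ≡ false →
    Step n (st stepA (suc c) j p k pr) (st stepB (suc c) j (set (set p (suc (suc c)) (just c)) (suc c) nothing) k pr)
  stepA-selfOverlap {c} e e' rewrite e | e' | ≡ᵇ-refl c = refl , refl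

  stepA-shift : ∀ {c d} → p (suc c) ≡ just d → k (suc c) ≡ false → d ≢ c → pr d ≢ L →
    Step n (st stepA (suc c) j p k pr)
           (st stepB (suc c) j (set (set p (suc (suc c)) (just (suc d))) (suc c) nothing) k pr)
  stepA-shift {c} {d} e e' d≢c prd≢L
    rewrite e | e' | ≢⇒≡ᵇ≡false d c d≢c | ≢L⇒isL≡false prd≢L = refl , refl

  stepA-copy : ∀ {c d} → p (suc c) ≡ just d → k (suc c) ≡ false → d ≢ c → pr d ≡ L →
    Step n (st stepA (suc c) j p k pr) (st copy (suc c) d p k pr)
  stepA-copy {c} {d} e e' d≢c prd rewrite e | e' | ≢⇒≡ᵇ≡false d c d≢c | prd = refl , refl

  stepB-free : ∀ {c} → p (suc c) ≡ nothing →
    Step n (st stepB (suc c) j p k pr) (st loop (suc (suc c)) j p k (pairFree pr c))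
  stepB-free e rewrite e = refl , refl

  stepB-factor : ∀ {i d} → p i ≡ just d → Step n (st stepB i j p k pr) (st loop i j p k pr)
  stepB-factor e rewrite e = refl , refl

module Invariant {A : Set} (w : List A) (fs : List Piece) where

  n : ℕ
  n = length w

  -- At the top of the loop, before position suc c: dn is the already processed part of the
  -- modified factorisation, covering 1 .. c, and the arrays store dn ++ rest.
  record Core (c : ℕ) (dn rest : List Piece) (p : ℕ → Maybe ℕ) (k : ℕ → Bool) (pr : ℕ → Pr) : Set where
    field
      endDone       : endFrom 0 dn ≡ c
      1≤c           : 1 ≤ c
      valid         : IsLZ77 w (dn ++ rest)
      poczOK        : ∀ q → p q ≡ poczOf (dn ++ rest) q
      konOK         : ∀ q → k q ≡ konOf (dn ++ rest) q
      prefixPaired  : PairedUpTo c pr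
      lastNotL      : pr c ≢ L
      factorsPaired : All (FactorPaired c pr) (occ dn)
      fewFactors    : nFactors (dn ++ rest) ≤ nFactors fs

  record Budget (c : ℕ) (dn rest : List Piece) (pr : ℕ → Pr) : Set where
    field
      bound : nFree dn + (nFree rest + credits c pr rest) ≤ nFree fs + 6 * nFactors fs

  Budget-snoc : ∀ {c c' dn x rest rest' pr pr'} →
    nFree (x ∷ []) + (nFree rest' + credits c' pr' rest') ≤ nFree rest + credits c pr rest →
    Budget c dn rest pr → Budget c' (dn ++ x ∷ []) rest' pr'
  Budget-snoc {dn = dn} {x} local b = record { bound =
    ≤-trans (≤-reflexive (trans (cong (_+ _) (nFree-++ dn (x ∷ []))) (+-assoc (nFree dn) _ _)))
            (≤-trans (+-monoʳ-≤ (nFree dn) local) (Budget.bound b)) }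

  Budget-free : ∀ {c dn t pr pr'} → Budget c dn (free ∷ t) pr → Budget (suc c) (dn ++ free ∷ []) t pr'
  Budget-free {c} {t = t} {pr' = pr'} = Budget-snoc (s≤s (+-monoʳ-≤ (nFree t) (credits≤ (suc c) pr' t)))

  Budget-unit : ∀ {c dn d t pr pr'} → Budget c dn (fac d 1 ∷ t) pr → Budget (suc c) (dn ++ free ∷ []) t pr'
  Budget-unit {c} {d = d} {t} {pr} {pr'} =
    Budget-snoc (≤-trans (≤-reflexive (sym (+-suc (nFree t) _)))
                  (+-monoʳ-≤ (nFree t) (+-mono-≤ (≤-trans (s≤s z≤n) (2≤credit c d pr)) (credits≤ (suc c) pr' t))))

  Budget-shift : ∀ {c dn d d' l t pr pr'} → suc (credit (suc c) d' pr') ≤ credit c d pr →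
    Budget c dn (fac d (suc (suc l)) ∷ t) pr → Budget (suc c) (dn ++ free ∷ []) (fac d' (suc l) ∷ t) pr'
  Budget-shift {t = t} lower =
    Budget-snoc (≤-trans (≤-reflexive (sym (+-suc (nFree t) _)))
                         (+-monoʳ-≤ (nFree t) (+-monoˡ-≤ (6 * nFactors t) lower)))

  module _ {c dn rest p k pr} (co : Core c dn rest p k pr) where
    open Core co

    validRest : ValidFrom w c rest
    validRest = subst (λ x → ValidFrom w x rest) endDone (ValidFrom-++⁻ʳ w 0 dn rest valid)

    poczRest : ∀ q → c < q → p q ≡ poczFrom c rest q
    poczRest q c<q rewrite sym endDone = trans (poczOK q) (poczFrom-++-> w 0 dn rest q valid c<q)

    konRest : ∀ q → c < q → k q ≡ konFrom c rest q
    konRest q c<q rewrite sym endDone = trans (konOK q) (konFrom-++-> 0 dn rest q c<q)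

    endRest : endFrom c rest ≡ n
    endRest = ValidFrom⇒endFrom w c rest validRest

  module _ {c dn d len t p k pr} (co : Core c dn (fac d len ∷ t) p k pr) where

    1≤def : 1 ≤ d
    1≤def = proj₁ (proj₂ (validRest co))

    def≤c : d ≤ c
    def≤c = proj₁ (proj₂ (proj₂ (validRest co)))

    defCopies : ∀ x → x < len → lookupW w (d + x) ≡ lookupW w (suc c + x)
    defCopies = proj₁ (proj₂ (proj₂ (proj₂ (validRest co))))

    validAfter : ValidFrom w (c + len) t
    validAfter = proj₂ (proj₂ (proj₂ (proj₂ (validRest co))))

  Core-<n : ∀ {c dn x t p k pr} → Core c dn (x ∷ t) p k pr → c < n
  Core-<n {c} {x = x} {t} co = <-≤-trans (<-endFrom w c x t (validRest co)) (≤-reflexive (endRest co))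

  Core-≤n : ∀ {c dn rest p k pr} → Core c dn rest p k pr → c ≤ n
  Core-≤n {c} {rest = rest} co = ≤-trans (≤-endFrom c rest) (≤-reflexive (endRest co))

  pocz-free : ∀ {c dn t p k pr} → Core c dn (free ∷ t) p k pr → p (suc c) ≡ nothing
  pocz-free {c} {t = t} co = trans (poczRest co (suc c) (n<1+n c)) (poczFrom-≤ (suc c) t (suc c) ≤-refl)

  pocz-factor : ∀ {c dn d len t p k pr} → Core c dn (fac d len ∷ t) p k pr → p (suc c) ≡ just d
  pocz-factor {c} co = trans (poczRest co (suc c) (n<1+n c)) (if-true (≡ᵇ-refl (suc c)))

  kon-unit : ∀ {c dn d t p k pr} → Core c dn (fac d 1 ∷ t) p k pr → k (suc c) ≡ true
  kon-unit {c} co = trans (konRest co (suc c) (n<1+n c))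
                          (if-true (subst (λ x → (suc c ≡ᵇ x) ≡ true) (+-comm 1 c) (≡ᵇ-refl (suc c))))

  kon-long : ∀ {c dn d l t p k pr} → Core c dn (fac d (suc (suc l)) ∷ t) p k pr → k (suc c) ≡ false
  kon-long {c} {d = d} {l} {t} co =
    trans (konRest co (suc c) (n<1+n c))
      (trans (if-false (≢⇒≡ᵇ≡false (suc c) (c + suc (suc l)) (<⇒≢ 1+c<end)))
             (konFrom-≤ w (c + suc (suc l)) t (suc c) (validAfter co) (<⇒≤ 1+c<end)))
    where
    1+c<end : suc c < c + suc (suc l)
    1+c<end = subst (suc c <_) (sym (+-suc c (suc l))) (s≤s (subst (suc c ≤_) (sym (+-suc c l)) (s≤s (m≤m+n c l))))

  Core-replaceRest : ∀ {c dn rest p k pr rest' p' k'} → Core c dn rest p k pr →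
    ValidFrom w c rest' → nFactors rest' ≤ nFactors rest →
    AgreeUpTo c p' p → (∀ q → c < q → p' q ≡ poczFrom c rest' q) →
    AgreeUpTo c k' k → (∀ q → c < q → k' q ≡ konFrom c rest' q) →
    Core c dn rest' p' k' pr
  Core-replaceRest {dn = dn} {rest} {p} {k} {rest' = rest'} {p'} {k'}
    co@record { endDone = refl } v' fewer p≤ p> k≤ k> = record
    { endDone = refl ; 1≤c = 1≤c ; valid = valid'
    ; poczOK = pocz' ; konOK = kon'
    ; prefixPaired = prefixPaired ; lastNotL = lastNotL ; factorsPaired = factorsPaired
    ; fewFactors = ≤-trans (≤-reflexive (nFactors-++ dn rest'))
                     (≤-trans (+-monoʳ-≤ (nFactors dn) fewer)
                       (≤-trans (≤-reflexive (sym (nFactors-++ dn rest))) fewFactors))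
    }
    where
    open Core co
    c = endFrom 0 dn
    valid' : IsLZ77 w (dn ++ rest')
    valid' = ValidFrom-++-replace w 0 dn rest rest' (λ _ → v') valid
    pocz' : ∀ q → p' q ≡ poczOf (dn ++ rest') q
    pocz' q with q ≤? c
    ... | yes q≤c = trans (p≤ q q≤c) (trans (poczOK q) (poczFrom-++-≤ 0 dn rest rest' q q≤c))
    ... | no q≰c = trans (p> q (≰⇒> q≰c)) (sym (poczFrom-++-> w 0 dn rest' q valid' (≰⇒> q≰c)))
    kon' : ∀ q → k' q ≡ konOf (dn ++ rest') q
    kon' q with q ≤? c
    ... | yes q≤c = trans (k≤ q q≤c) (trans (konOK q) (konFrom-++-≤ w 0 dn rest rest' q q≤c (validRest co) v'))
    ... | no q≰c = trans (k> q (≰⇒> q≰c)) (sym (konFrom-++-> 0 dn rest' q (≰⇒> q≰c)))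

  Core-snoc : ∀ {c dn x t p k pr c' pr'} → Core c dn (x ∷ t) p k pr →
    endFrom c (x ∷ []) ≡ c' → c ≤ c' → (∀ q → q < c → pr' q ≡ pr q) → (pr c ≡ R → pr' c ≡ R) →
    PairedUpTo c' pr' → pr' c' ≢ L → All (FactorPaired c' pr') (occFrom c (x ∷ [])) →
    Core c' (dn ++ x ∷ []) t p k pr'
  Core-snoc {c} {dn} {x} {t} {p} {k} {c' = c'} {pr'} co end≡ c≤c' ag agR P notL new = record
    { endDone       = trans (endFrom-++ 0 dn (x ∷ [])) (trans (cong (λ e → endFrom e (x ∷ [])) endDone) end≡)
    ; 1≤c           = ≤-trans 1≤c c≤c'
    ; valid         = subst (ValidFrom w 0) (sym assoc) valid
    ; poczOK        = λ q → subst (λ fs' → p q ≡ poczOf fs' q) (sym assoc) (poczOK q)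
    ; konOK         = λ q → subst (λ fs' → k q ≡ konOf fs' q) (sym assoc) (konOK q)
    ; prefixPaired  = P
    ; lastNotL      = notL
    ; factorsPaired = subst (All (FactorPaired c' pr')) (sym (occFrom-++ 0 dn (x ∷ [])))
                        (++⁺ (All.map (FactorPaired-stable c≤c' ag agR) factorsPaired)
                             (subst (λ e → All (FactorPaired c' pr') (occFrom e (x ∷ []))) (sym endDone) new))
    ; fewFactors    = subst (λ fs' → nFactors fs' ≤ nFactors fs) (sym assoc) fewFactors
    }
    where
    open Core co
    assoc : (dn ++ x ∷ []) ++ t ≡ dn ++ x ∷ t
    assoc = ++-assoc dn (x ∷ []) t

  Core-free : ∀ {c dn t p k pr} → Core c dn (free ∷ t) p k pr → Core (suc c) (dn ++ free ∷ []) t p k (pairFree pr c)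
  Core-free {c} {pr = pr} co =
    Core-snoc co refl (n≤1+n c) (pairFree-< pr c) (λ e → proj₁ (pairFree-R pr c e))
      (proj₁ next) (proj₂ next) []
    where
    next = pairFree-PairedUpTo (Core.1≤c co) (Core.prefixPaired co) (Core.lastNotL co)

  Core-agree : ∀ {c dn rest p k pr pr'} → AgreeUpTo c pr' pr → Core c dn rest p k pr → Core c dn rest p k pr'
  Core-agree {c} {pr = pr} {pr'} ag co = record
    { endDone = endDone ; 1≤c = 1≤c ; valid = valid ; poczOK = poczOK ; konOK = konOK
    ; prefixPaired  = PairedUpTo-agree 1≤c ≤-refl ag prefixPaired
    ; lastNotL      = λ e → lastNotL (trans (sym (ag c ≤-refl)) e)
    ; factorsPaired = All.map (FactorPaired-stable ≤-refl (λ q q<c → ag q (<⇒≤ q<c)) (trans (ag c ≤-refl)))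
                              factorsPaired
    ; fewFactors    = fewFactors
    }
    where open Core co

  Core-unitFactor : ∀ {c dn d t p k pr} → Core c dn (fac d 1 ∷ t) p k pr →
    Core c dn (free ∷ t) (set p (suc c) nothing) (set k (suc c) false) pr
  Core-unitFactor {c} {d = d} {t} {p} {k} co =
    Core-replaceRest co v' (n≤1+n _) (set-agree p nothing (n<1+n c)) p> (set-agree k false (n<1+n c)) k>
    where
    c+1≡ = +-comm c 1
    v' : ValidFrom w (suc c) t
    v' = subst (λ x → ValidFrom w x t) c+1≡ (validAfter co)
    p> : ∀ q → c < q → set p (suc c) nothing q ≡ poczFrom (suc c) t q
    p> q c<q with q ≟ suc c
    ... | yes refl = trans (set-≡ p (suc c) nothing) (sym (poczFrom-≤ (suc c) t (suc c) ≤-refl))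
    ... | no q≢ = trans (set-≢ p (suc c) nothing q q≢)
                    (trans (poczRest co q c<q)
                      (trans (if-false (≢⇒≡ᵇ≡false q (suc c) q≢)) (cong (λ x → poczFrom x t q) c+1≡)))
    k> : ∀ q → c < q → set k (suc c) false q ≡ konFrom (suc c) t q
    k> q c<q with q ≟ suc c
    ... | yes refl = trans (set-≡ k (suc c) false) (sym (konFrom-≤ w (suc c) t (suc c) v' ≤-refl))
    ... | no q≢ = trans (set-≢ k (suc c) false q q≢)
                    (trans (konRest co q c<q)
                      (trans (if-false (≢⇒≡ᵇ≡false q (c + 1) (λ e → q≢ (trans e c+1≡))))
                             (cong (λ x → konFrom x t q) c+1≡)))

  Core-shift : ∀ {c dn d l t p k pr} → Core c dn (fac d (suc (suc l)) ∷ t) p k pr →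
    ∀ d' → 1 ≤ d' → d' ≤ suc c → (∀ x → x < suc l → lookupW w (d' + x) ≡ lookupW w (suc (suc c) + x)) →
    Core c dn (free ∷ fac d' (suc l) ∷ t) (set (set p (suc (suc c)) (just d')) (suc c) nothing) k pr
  Core-shift {c} {d = d} {l} {t} {p} {k} co d' 1≤d' d'≤ copies =
    Core-replaceRest co (s≤s z≤n , 1≤d' , d'≤ , copies , v') ≤-refl p≤ p> (λ _ _ → refl) k>
    where
    p' = set (set p (suc (suc c)) (just d')) (suc c) nothing
    end≡ : c + suc (suc l) ≡ suc c + suc l
    end≡ = +-suc c (suc l)
    v' : ValidFrom w (suc c + suc l) t
    v' = subst (λ x → ValidFrom w x t) end≡ (validAfter co)
    p≤ : AgreeUpTo c p' p
    p≤ q q≤c = trans (set-agree (set p (suc (suc c)) (just d')) nothing (n<1+n c) q q≤c)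
                     (set-agree p (just d') (≤-trans (n<1+n c) (n≤1+n _)) q q≤c)
    p> : ∀ q → c < q → p' q ≡ poczFrom (suc c) (fac d' (suc l) ∷ t) q
    p> q c<q with q ≟ suc c
    ... | yes refl = trans (set-≡ (set p (suc (suc c)) (just d')) (suc c) nothing)
                           (sym (poczFrom-≤ (suc c) (fac d' (suc l) ∷ t) (suc c) ≤-refl))
    ... | no q≢ with q ≟ suc (suc c)
    ...   | yes refl = trans (set-≢ (set p (suc (suc c)) (just d')) (suc c) nothing q q≢)
                         (trans (set-≡ p (suc (suc c)) (just d')) (sym (if-true (≡ᵇ-refl (suc (suc c))))))
    ...   | no q≢' = trans (set-≢ (set p (suc (suc c)) (just d')) (suc c) nothing q q≢)
                       (trans (set-≢ p (suc (suc c)) (just d') q q≢')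
                         (trans (poczRest co q c<q)
                           (trans (if-false (≢⇒≡ᵇ≡false q (suc c) q≢))
                             (trans (cong (λ x → poczFrom x t q) end≡)
                                    (sym (if-false (≢⇒≡ᵇ≡false q (suc (suc c)) q≢')))))))
    k> : ∀ q → c < q → k q ≡ konFrom (suc c) (fac d' (suc l) ∷ t) q
    k> q c<q = trans (konRest co q c<q) (cong (λ x → if q ≡ᵇ x then true else konFrom x t q) end≡)

  Core-back : ∀ {c dn d L' r p k pr} → Core c dn (fac d (suc L') ∷ r) p k pr → 2 ≤ L' →
    Core c dn (fac d L' ∷ free ∷ r) p (set (set k (c + L') true) (c + suc L') false) pr
  Core-back {c} {d = d} {L'} {r} {p} {k} co 2≤L' =
    Core-replaceRest co v' ≤-refl (λ _ _ → refl) p> k≤ k>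
    where
    k' = set (set k (c + L') true) (c + suc L') false
    end≡ = +-suc c L'
    c<c+L' : c < c + L'
    c<c+L' = m<m+n c (≤-trans (s≤s z≤n) 2≤L')
    c+L'<end : c + L' < c + suc L'
    c+L'<end = +-monoʳ-< c (n<1+n L')
    vr : ValidFrom w (suc (c + L')) r
    vr = subst (λ x → ValidFrom w x r) end≡ (validAfter co)
    v' : ValidFrom w c (fac d L' ∷ free ∷ r)
    v' = ≤-trans (s≤s z≤n) 2≤L' , 1≤def co , def≤c co , (λ x x< → defCopies co x (m<n⇒m<1+n x<)) , vr
    p> : ∀ q → c < q → p q ≡ poczFrom c (fac d L' ∷ free ∷ r) q
    p> q c<q = trans (poczRest co q c<q) (cong (λ x → if q ≡ᵇ suc c then just d else poczFrom x r q) end≡)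
    k≤ : AgreeUpTo c k' k
    k≤ q q≤c = trans (set-agree (set k (c + L') true) false (<-trans c<c+L' c+L'<end) q q≤c)
                     (set-agree k true c<c+L' q q≤c)
    k> : ∀ q → c < q → k' q ≡ konFrom c (fac d L' ∷ free ∷ r) q
    k> q c<q with q ≟ c + suc L'
    ... | yes refl = trans (set-≡ (set k (c + L') true) (c + suc L') false)
                       (sym (trans (if-false (≢⇒≡ᵇ≡false (c + suc L') (c + L') (>⇒≢ c+L'<end)))
                                   (konFrom-≤ w (suc (c + L')) r (c + suc L') vr (≤-reflexive end≡))))
    ... | no q≢ with q ≟ c + L'
    ...   | yes refl = trans (set-≢ (set k (c + L') true) (c + suc L') false (c + L') q≢)
                         (trans (set-≡ k (c + L') true) (sym (if-true (≡ᵇ-refl (c + L')))))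
    ...   | no q≢' = trans (set-≢ (set k (c + L') true) (c + suc L') false q q≢)
                       (trans (set-≢ k (c + L') true q q≢')
                         (trans (konRest co q c<q)
                           (trans (if-false (≢⇒≡ᵇ≡false q (c + suc L') q≢))
                             (trans (cong (λ x → konFrom x r q) end≡)
                                    (sym (if-false (≢⇒≡ᵇ≡false q (c + L') q≢')))))))

  -- Case (d) of step (A), followed by cutting the factor back until it ends on an R.
  module CopyPhase {c dn d l t0 p k pr0} (co : Core c dn (fac d (suc (suc l)) ∷ t0) p k pr0)
                   (prd : pr0 d ≡ L) (d<c : d < c) where

    len : ℕ
    len = suc (suc l)

    1≤d : 1 ≤ d
    1≤d = 1≤def co

    record Copied (t : ℕ) (pr : ℕ → Pr) : Set where
      field
        agreeOld     : AgreeUpTo c pr pr0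
        prefixPaired : PairedUpTo (c + t) pr
        copies       : ∀ u → u < t → pr (suc c + u) ≡ pr (d + u)

    Copied-zero : Copied 0 pr0
    Copied-zero = record
      { agreeOld     = λ _ _ → refl
      ; prefixPaired = subst (λ x → PairedUpTo x pr0) (sym (+-identityʳ c)) (Core.prefixPaired co)
      ; copies       = λ _ ()
      }

    Copied-restrict : ∀ {t t' pr pr'} → t' ≤ t → AgreeUpTo (c + t') pr' pr → Copied t pr → Copied t' pr'
    Copied-restrict {t} {t'} {pr} {pr'} t'≤t ag cp = record
      { agreeOld     = λ q q≤c → trans (ag q (≤-trans q≤c (m≤m+n c t'))) (agreeOld q q≤c)
      ; prefixPaired = PairedUpTo-agree (≤-trans (Core.1≤c co) (m≤m+n c t')) (+-monoʳ-≤ c t'≤t) ag prefixPaired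
      ; copies       = λ u u<t' → trans (ag (suc c + u) (subst (_≤ c + t') (+-suc c u) (+-monoʳ-≤ c u<t')))
                                (trans (copies u (<-≤-trans u<t' t'≤t))
                                  (sym (ag (d + u) (≤-trans (+-monoˡ-≤ u (<⇒≤ d<c)) (+-monoʳ-≤ c (<⇒≤ u<t'))))))
      }
      where open Copied cp

    -- The letter before the copied one is the copy of the letter before its model,
    -- except for the first letter, which follows the non-L letter at c.
    nextAdjacent : ∀ t {pr} → Copied t pr → Adjacent (pr (c + t)) (pr (d + t))
    nextAdjacent zero {pr} cp =
      subst₂ Adjacent (cong pr (sym (+-identityʳ c))) (cong pr (sym (+-identityʳ d)))
        (subst (Adjacent (pr c)) (sym (trans (agreeOld d (<⇒≤ d<c)) prd))
          (Adjacent-toL (λ e → Core.lastNotL co (trans (sym (agreeOld c ≤-refl)) e))))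
      where open Copied cp
    nextAdjacent (suc t) {pr} cp =
      subst₂ Adjacent (sym (trans (cong pr (+-suc c t)) (copies t ≤-refl))) (cong pr (sym (+-suc d t)))
        (PairedUpTo.adjacent prefixPaired (d + t) (≤-trans 1≤d (m≤m+n d t))
          (subst (_≤ c + suc t) (+-suc d t) (+-monoˡ-≤ (suc t) (<⇒≤ d<c))))
      where open Copied cp

    Copied-suc : ∀ t {pr} → Copied t pr → pr (suc (c + t)) ≡ pr (d + t) → Copied (suc t) pr
    Copied-suc t {pr} cp new = record
      { agreeOld     = agreeOld
      ; prefixPaired = subst (λ x → PairedUpTo x pr) (sym (+-suc c t))
                         (PairedUpTo-suc (≤-trans (Core.1≤c co) (m≤m+n c t)) prefixPaired
                           (subst (Adjacent (pr (c + t))) (sym new) (nextAdjacent t cp)))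
      ; copies       = λ u u<1+t → [ copies u , (λ { refl → new }) ]′ (m≤n⇒m<n∨m≡n (≤-pred u<1+t))
      }
      where open Copied cp

    copyOne : ∀ t {pr} → Copied t pr → Copied (suc t) (set pr (suc (c + t)) (pr (d + t)))
    copyOne t {pr} cp = Copied-suc t (Copied-restrict ≤-refl agree cp)
      (trans (set-≡ pr (suc (c + t)) (pr (d + t))) (sym (agree (d + t) (+-monoˡ-≤ t (<⇒≤ d<c)))))
      where
      agree = set-agree pr (pr (d + t)) (n<1+n (c + t))

    konInside : ∀ t → t < len → k (suc (c + t)) ≡ (suc (c + t) ≡ᵇ c + len)
    konInside t t<len with suc (c + t) ≡ᵇ c + len in eq
    ... | true  = trans (konRest co (suc (c + t)) (s≤s (m≤m+n c t))) (if-true eq)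
    ... | false = trans (konRest co (suc (c + t)) (s≤s (m≤m+n c t)))
                    (trans (if-false eq) (konFrom-≤ w (c + len) t0 (suc (c + t)) (validAfter co)
                      (subst (_≤ c + len) (+-suc c t) (+-monoʳ-≤ c t<len))))

    copyLoop : ∀ m t {i j pr} → t + suc m ≡ len → i ≡ suc (c + t) → j ≡ d + t → Copied t pr →
      Σ ℕ λ j' → Σ (ℕ → Pr) λ pr' →
        Steps n (suc m) (st copy i j p k pr) (st back (suc (c + len)) j' p k pr') × Copied len pr'
    copyLoop zero t {pr = pr} t+1≡len refl refl cp =
      suc (d + t) , pr' , (refl , last) ∷ [] , subst (λ x → Copied x pr') 1+t≡len (copyOne t cp)
      where
      pr' = set pr (suc (c + t)) (pr (d + t))
      1+t≡len = trans (+-comm 1 t) t+1≡len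
      ends : suc (c + t) ≡ c + len
      ends = trans (sym (+-suc c t)) (cong (c +_) 1+t≡len)
      last : step n (st copy (suc (c + t)) (d + t) p k pr) ≡ st back (suc (c + len)) (suc (d + t)) p k pr'
      last rewrite trans (konInside t (≤-reflexive 1+t≡len))
                         (subst (λ x → (suc (c + t) ≡ᵇ x) ≡ true) ends (≡ᵇ-refl (suc (c + t)))) =
        cong (λ x → st back (suc x) (suc (d + t)) p k pr') ends
    copyLoop (suc m) t {pr = pr} t+2+m≡len refl refl cp
      with copyLoop m (suc t) (trans (sym (+-suc t (suc m))) t+2+m≡len) (cong suc (sym (+-suc c t)))
                    (sym (+-suc d t)) (copyOne t cp)
    ... | j' , pr' , rest , cp' =
      j' , pr' , (refl , cong (λ b → st (if b then back else copy) (suc (suc (c + t))) (suc (d + t)) p k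
                                       (set pr (suc (c + t)) (pr (d + t))))
                              notLast) ∷ rest , cp'
      where
      2+t≤len : suc (suc t) ≤ len
      2+t≤len = subst (suc (suc t) ≤_) t+2+m≡len
                  (subst (_≤ t + suc (suc m)) (+-comm t 2) (+-monoʳ-≤ t (s≤s (s≤s z≤n))))
      notLast : k (suc (c + t)) ≡ false
      notLast = trans (konInside t (≤-trans (n≤1+n _) 2+t≤len))
                  (≢⇒≡ᵇ≡false (suc (c + t)) (c + len)
                    (<⇒≢ (subst (_≤ c + len) (trans (+-suc c (suc t)) (cong suc (+-suc c t)))
                                (+-monoʳ-≤ c 2+t≤len))))

    copyAll : Σ ℕ λ j' → Σ (ℕ → Pr) λ pr' →
                Steps n len (st copy (suc c) d p k pr0) (st back (suc (c + len)) j' p k pr') × Copied len pr'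
    copyAll = copyLoop (suc l) 0 refl (cong suc (sym (+-identityʳ c))) (sym (+-identityʳ d)) Copied-zero

    record Backing (L' : ℕ) (r : List Piece) (b : ℕ) (k' : ℕ → Bool) (pr : ℕ → Pr) : Set where
      field
        core        : Core c dn (fac d L' ∷ r) p k' pr0
        copied      : Copied L' pr
        freed       : nFree r ≡ b + nFree t0
        sameFactors : nFactors r ≡ nFactors t0
        room        : b + stepsBackToR (pr (c + L')) ≤ 2

    backOne : ∀ {L' r b k' pr} → 2 ≤ L' → pr (c + suc L') ≢ R → Backing (suc L') r b k' pr →
      Backing L' (free ∷ r) (suc b) (set (set k' (c + L') true) (c + suc L') false) (set pr (c + suc L') N)
    backOne {L'} {r} {b} {k'} {pr} 2≤L' notR bk = record
      { core        = Core-back core 2≤L'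
      ; copied      = Copied-restrict (n≤1+n L') agree copied
      ; freed       = cong suc freed
      ; sameFactors = sameFactors
      ; room        = ≤-trans (≤-reflexive (trans (cong (λ x → suc b + stepsBackToR x) (agree (c + L') ≤-refl))
                                                  (sym (+-suc b _))))
                              (≤-trans (+-monoʳ-≤ b fewerSteps) room)
      }
      where
      open Backing bk
      agree = set-agree pr N (+-monoʳ-< c (n<1+n L'))
      fewerSteps : stepsBackToR (pr (c + L')) < stepsBackToR (pr (c + suc L'))
      fewerSteps = Adjacent-stepsBackToR
        (subst (Adjacent (pr (c + L'))) (cong pr (sym (+-suc c L')))
          (PairedUpTo.adjacent (Copied.prefixPaired copied) (c + L') (≤-trans (Core.1≤c co) (m≤m+n c L'))
            (≤-reflexive (sym (+-suc c L')))))
        notR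

    backStep : ∀ {L' j k' pr} → pr (c + suc L') ≢ R →
      Step n (st back (suc (c + suc L')) j p k' pr)
             (st back (suc (c + L')) j p (set (set k' (c + L') true) (c + suc L') false) (set pr (c + suc L') N))
    backStep {L'} {j} {k'} {pr} notR = refl , next
      where
      next : step n (st back (suc (c + suc L')) j p k' pr) ≡
             st back (suc (c + L')) j p (set (set k' (c + L') true) (c + suc L') false) (set pr (c + suc L') N)
      next rewrite ≢R⇒isR≡false notR =
        cong₂ (λ x y → st back x j p (set (set k' y true) (c + suc L') false) (set pr (c + suc L') N))
              (+-suc c L') (cong (_∸ 1) (+-suc c L'))

    backStop : ∀ {L' j k' pr} → pr (c + L') ≡ R →
      Step n (st back (suc (c + L')) j p k' pr) (st stepB (suc (c + L')) j p k' pr)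
    backStop e rewrite e = refl , refl

    record BackResult (l' : ℕ) (b : ℕ) (k' : ℕ → Bool) (pr : ℕ → Pr) (j : ℕ) : Set where
      field
        cuts l* b* : ℕ
        r*         : List Piece
        k*         : ℕ → Bool
        pr*        : ℕ → Pr
        steps      : Steps n (suc cuts) (st back (suc (c + suc (suc l'))) j p k' pr)
                                        (st stepB (suc (c + suc (suc l*))) j p k* pr*)
        backing    : Backing (suc (suc l*)) r* b* k* pr*
        endsR      : pr* (c + suc (suc l*)) ≡ R
        cuts+l*    : cuts + l* ≡ l'
        cuts+b     : cuts + b ≡ b*

    finishBack : ∀ {l' r b k' pr} j → Backing (suc (suc l')) r b k' pr → pr (c + suc (suc l')) ≡ R →
                 BackResult l' b k' pr j
    finishBack {l'} {r} {b} {k'} {pr} j bk endR = record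
      { cuts = 0 ; l* = l' ; b* = b ; r* = r ; k* = k' ; pr* = pr
      ; steps = backStop endR ∷ [] ; backing = bk ; endsR = endR ; cuts+l* = refl ; cuts+b = refl }

    -- The first two copied letters copy the pair at d, d+1.
    secondR : ∀ {r b k' pr} → Backing 2 r b k' pr → pr (c + 2) ≡ R
    secondR {pr = pr} bk =
      trans (cong pr (+-suc c 1)) (trans (copies 1 (s≤s (s≤s z≤n)))
        (trans (agreeOld (d + 1) (subst (_≤ c) (+-comm 1 d) d<c))
          (subst (λ x → pr0 x ≡ R) (+-comm 1 d)
            (Adjacent-fromL (subst (λ x → Adjacent x (pr0 (suc d))) prd
              (PairedUpTo.adjacent (Core.prefixPaired co) d 1≤d d<c))))))
      where open Copied (Backing.copied bk)

    backLoop : ∀ l' {r b k' pr} j → Backing (suc (suc l')) r b k' pr → BackResult l' b k' pr j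
    backLoop zero j bk = finishBack j bk (secondR bk)
    backLoop (suc l'') {k' = k'} {pr} j bk with pr (c + suc (suc (suc l''))) ≟R
    ... | yes endR = finishBack j bk endR
    ... | no notR with backLoop l'' j (backOne (s≤s (s≤s z≤n)) notR bk)
    ...   | res = record
      { cuts = suc cuts ; l* = l* ; b* = b* ; r* = r* ; k* = k* ; pr* = pr*
      ; steps = backStep notR ∷ steps ; backing = backing ; endsR = endsR
      ; cuts+l* = cong suc cuts+l* ; cuts+b = trans (sym (+-suc cuts _)) cuts+b }
      where open BackResult res

    closeFactor : ∀ {l* r* b* k* pr*} → Backing (suc (suc l*)) r* b* k* pr* → pr* (c + suc (suc l*)) ≡ R →
      Budget c dn (fac d len ∷ t0) pr0 →
      Core (c + suc (suc l*)) (dn ++ fac d (suc (suc l*)) ∷ []) r* p k* pr* ×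
      Budget (c + suc (suc l*)) (dn ++ fac d (suc (suc l*)) ∷ []) r* pr*
    closeFactor {l*} {r*} {b*} {k*} {pr*} bk endR bud =
      Core-snoc core refl (m≤m+n c _) (λ q q<c → agreeOld q (<⇒≤ q<c)) (trans (agreeOld c ≤-refl))
        prefixPaired (λ e → case trans (sym e) endR of λ ()) (newFactor ∷ []) ,
      Budget-snoc local bud
      where
      open Backing bk
      open Copied copied
      newFactor : FactorPaired (c + suc (suc l*)) pr* (suc c , d , suc (suc l*))
      newFactor = paired (s≤s (<⇒≤ d<c)) (≤-reflexive (sym end≡))
        (trans (cong pr* (sym (+-identityʳ (suc c)))) (trans (copies 0 (s≤s z≤n))
          (trans (cong pr* (+-identityʳ d)) (trans (agreeOld d (<⇒≤ d<c)) prd))))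
        (subst (λ x → pr* x ≡ R) end≡ endR)
        copies
        where
        end≡ : c + suc (suc l*) ≡ suc (suc c + l*)
        end≡ = trans (+-suc c (suc l*)) (cong suc (+-suc c l*))
      b*≤2 : b* ≤ 2
      b*≤2 = subst (_≤ 2) (+-identityʳ b*) (subst (λ x → b* + stepsBackToR x ≤ 2) endR room)
      credit≡2 : credit c d pr0 ≡ 2
      credit≡2 = credit-L {pr = pr0} (<⇒≢ d<c) prd
      creditsLeft : credits (c + suc (suc l*)) pr* r* ≤ 6 * nFactors t0
      creditsLeft = subst (λ x → credits _ pr* r* ≤ 6 * x) sameFactors (credits≤ _ pr* r*)
      local : 0 + (nFree r* + credits (c + suc (suc l*)) pr* r*) ≤ nFree t0 + credits c pr0 (fac d len ∷ t0)
      local = begin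
        nFree r* + credits (c + suc (suc l*)) pr* r*  ≤⟨ +-mono-≤ (≤-reflexive freed) creditsLeft ⟩
        b* + nFree t0 + 6 * nFactors t0               ≤⟨ +-monoˡ-≤ (6 * nFactors t0) (+-monoˡ-≤ (nFree t0) b*≤2) ⟩
        2 + nFree t0 + 6 * nFactors t0                ≡⟨ cong (_+ 6 * nFactors t0) (+-comm 2 (nFree t0)) ⟩
        nFree t0 + 2 + 6 * nFactors t0                ≡⟨ +-assoc (nFree t0) 2 _ ⟩
        nFree t0 + (2 + 6 * nFactors t0)              ≡⟨ cong (λ x → nFree t0 + (x + 6 * nFactors t0)) (sym credit≡2) ⟩
        nFree t0 + credits c pr0 (fac d len ∷ t0)     ∎
        where open ≤-Reasoning

    record Outcome : Set where
      field
        cuts l* j' : ℕ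
        r*         : List Piece
        k*         : ℕ → Bool
        pr*        : ℕ → Pr
        steps      : Steps n (len + suc cuts) (st copy (suc c) d p k pr0)
                                                  (st stepB (suc (c + suc (suc l*))) j' p k* pr*)
        core       : Core (c + suc (suc l*)) (dn ++ fac d (suc (suc l*)) ∷ []) r* p k* pr*
        budget     : Budget (c + suc (suc l*)) (dn ++ fac d (suc (suc l*)) ∷ []) r* pr*
        endsR      : pr* (c + suc (suc l*)) ≡ R
        cuts≤2     : cuts ≤ 2
        cuts+l*    : cuts + l* ≡ l

    copyAndCut : Budget c dn (fac d len ∷ t0) pr0 → Outcome
    copyAndCut budget with copyAll
    ... | j' , pr' , copying , copied with backLoop l j' start
      where
      start : Backing len t0 0 k pr'
      start = record { core = co ; copied = copied ; freed = refl ; sameFactors = refl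
                     ; room = stepsBackToR≤2 (pr' (c + len)) }
    ...   | res = record
      { cuts = cuts ; l* = l* ; j' = j' ; r* = r* ; k* = k* ; pr* = pr*
      ; steps = Steps-++ copying steps
      ; core = proj₁ closed ; budget = proj₂ closed ; endsR = endsR
      ; cuts≤2 = subst (_≤ 2) (sym (trans (sym (+-identityʳ cuts)) cuts+b))
                       (m+n≤o⇒m≤o b* {stepsBackToR (pr* _)} (Backing.room backing))
      ; cuts+l* = cuts+l* }
      where
      open BackResult res
      closed = closeFactor backing endsR budget

time-free : ∀ r → 2 + (5 * r + 2) ≤ 5 * suc r + 1
time-free r = subst (2 + (5 * r + 2) ≤_) (eq r) (m≤m+n _ 2)
  where
  eq : ∀ r → 2 + (5 * r + 2) + 2 ≡ 5 * suc r + 1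
  eq = solve-∀

-- Case (d) spends the length of the factor on copying and at most three steps on cutting back,
-- against five steps for each of the at least two positions it covers.
time-copy : ∀ cuts l* r → cuts ≤ 2 →
            2 + (suc (suc (cuts + l*)) + suc cuts) + (5 * r + 2) ≤ 5 * (suc (suc l*) + r) + 1
time-copy cuts l* r cuts≤2 = begin
  2 + (suc (suc (cuts + l*)) + suc cuts) + (5 * r + 2) ≡⟨ eq₁ cuts l* r ⟩
  2 * cuts + (7 + l* + 5 * r)                           ≤⟨ +-monoˡ-≤ _ (*-monoʳ-≤ 2 cuts≤2) ⟩
  4 + (7 + l* + 5 * r)                                  ≤⟨ m≤n+m _ (4 * l*) ⟩
  4 * l* + (4 + (7 + l* + 5 * r))                       ≡⟨ eq₂ l* r ⟩
  5 * (suc (suc l*) + r) + 1                            ∎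
  where
  open ≤-Reasoning
  eq₁ : ∀ cuts l* r → 2 + (suc (suc (cuts + l*)) + suc cuts) + (5 * r + 2) ≡ 2 * cuts + (7 + l* + 5 * r)
  eq₁ = solve-∀
  eq₂ : ∀ l* r → 4 * l* + (4 + (7 + l* + 5 * r)) ≡ 5 * (suc (suc l*) + r) + 1
  eq₂ = solve-∀

module MainLoop {A : Set} (w : List A) (fs : List Piece) where
  open Invariant w fs
  open Transitions n

  Goal : St → Set
  Goal s = Σ (List Piece) λ fs' →
    IsLZ77 w fs' × Stores n fs' (St.pocz s) (St.kon s) × IsPairing n (St.pair s) ×
    P1 n (St.pair s) × P2 fs' (St.pair s) × P3 fs' (St.pair s) ×
    (nFree fs' ≤ nFree fs + 6 * nFactors fs) × (nFactors fs' ≤ nFactors fs)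

  record HaltsWithin (T : ℕ) (s : St) : Set where
    constructor halts
    field
      final : St
      runs  : run n T s ≡ just final
      goal  : Goal final

  Steps-then : ∀ {t T B s s'} → Steps n t s s' → HaltsWithin T s' → t + T ≤ B → HaltsWithin B s
  Steps-then {T = T} {s = s} steps (halts f r g) t+T≤B =
    halts f (run-mono n s t+T≤B (trans (Steps-run T steps) r)) g

  HaltsWithin-mono : ∀ {T T' s} → T ≤ T' → HaltsWithin T s → HaltsWithin T' s
  HaltsWithin-mono {s = s} T≤T' (halts f r g) = halts f (run-mono n s T≤T' r) g

  goalAt : ∀ {dn p k pr} → Core n dn [] p k pr → Budget n dn [] pr → ∀ i j → Goal (st done i j p k pr)
  goalAt {dn} {p} {k} {pr} co bud i j =
    dn ++ [] , valid , (λ q _ _ → poczOK q , konOK q) ,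
    PairedUpTo⇒IsPairing prefixPaired lastNotL , PairedUpTo⇒P1 prefixPaired ,
    (λ _ _ _ mem → FactorPaired⇒P2 prefixPaired (All.lookup factorsPaired' mem)) ,
    (λ _ _ _ mem → FactorPaired⇒P3 (All.lookup factorsPaired' mem)) ,
    subst (_≤ _) (trans (+-identityʳ (nFree dn)) (cong nFree (sym (++-identityʳ dn)))) (Budget.bound bud) ,
    fewFactors
    where
    open Core co
    factorsPaired' : All (FactorPaired n pr) (occ (dn ++ []))
    factorsPaired' = subst (λ x → All (FactorPaired n pr) (occ x)) (sym (++-identityʳ dn)) factorsPaired

  halt : ∀ {c dn p k pr} j → c ≡ n → Core c dn [] p k pr → Budget c dn [] pr →
         HaltsWithin 1 (st loop (suc c) j p k pr)
  halt {p = p} {k} {pr} j refl co bud =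
    Steps-then (loop→done (n<1+n n) ∷ []) (halts (st done (suc n) j p k pr) refl (goalAt co bud (suc n) j)) ≤-refl

  Loop : ℕ → Set
  Loop r = ∀ {c dn rest p k pr} j → c + r ≡ n → Core c dn rest p k pr → Budget c dn rest pr →
           HaltsWithin (5 * r + 1) (st loop (suc c) j p k pr)

  afterFree : ∀ {r c dn t p k pr} j → Loop r → c + suc r ≡ n → Core c dn (free ∷ t) p k pr →
    Budget (suc c) (dn ++ free ∷ []) t (pairFree pr c) → HaltsWithin (5 * r + 2) (st stepB (suc c) j p k pr)
  afterFree {r} {c} j rec e co budget =
    Steps-then (stepB-free (pocz-free co) ∷ []) (rec j (trans (sym (+-suc c r)) e) (Core-free co) budget)
               (≤-reflexive (sym (+-suc (5 * r) 1)))

  afterCut : ∀ r → (∀ {r'} → r' ≤ r → Loop r') → ∀ {c dn rest p k pr} j → c + r ≡ n →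
    Core c dn rest p k pr → Budget c dn rest pr → pr c ≡ R → HaltsWithin (5 * r + 2) (st stepB (suc c) j p k pr)
  afterCut r rec {c} {rest = []} {p} {k} {pr} j e co budget prc with endRest co
  ... | refl =
    Steps-then (stepB-free (poczRest co (suc c) (n<1+n c)) ∷ loop→done (m<n⇒m<1+n (n<1+n n)) ∷ [])
      (halts _ refl (goalAt (Core-agree (pairFree-R-agree pr c prc) co) record { bound = Budget.bound budget }
                            (suc (suc c)) j))
      (m≤n+m 2 (5 * r))
  afterCut zero rec {c} {rest = free ∷ t} j e co budget prc =
    ⊥-elim (<⇒≢ (Core-<n co) (trans (sym (+-identityʳ c)) e))
  afterCut (suc r) rec {rest = free ∷ t} j e co budget prc =
    HaltsWithin-mono (+-monoˡ-≤ 2 (*-monoʳ-≤ 5 (n≤1+n r))) (afterFree j (rec (n≤1+n r)) e co (Budget-free budget))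
  afterCut r rec {rest = fac d len ∷ t} j e co budget prc =
    Steps-then (stepB-factor (pocz-factor co) ∷ []) (rec ≤-refl j e co budget) (≤-reflexive (sym (+-suc (5 * r) 1)))

  viaFree : ∀ {r c dn t p k pr p' k'} j → Loop r → c + suc r ≡ n →
    Steps n 2 (st loop (suc c) j p k pr) (st stepB (suc c) j p' k' pr) →
    Core c dn (free ∷ t) p' k' pr → Budget (suc c) (dn ++ free ∷ []) t (pairFree pr c) →
    HaltsWithin (5 * suc r + 1) (st loop (suc c) j p k pr)
  viaFree {r} j rec e steps co bud = Steps-then steps (afterFree j rec e co bud) (time-free r)

  shiftCase : ∀ {r c dn d l t p k pr} j → Loop r → c + suc r ≡ n → Core c dn (fac d (suc (suc l)) ∷ t) p k pr →
    Budget c dn (fac d (suc (suc l)) ∷ t) pr → d ≢ c → pr d ≢ L →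
    HaltsWithin (5 * suc r + 1) (st loop (suc c) j p k pr)
  shiftCase {c = c} {d = d} {pr = pr} j rec e co bud d≢c prd≢L =
    viaFree j rec e (loop→stepA (Core-<n co) ∷ stepA-shift (pocz-factor co) (kon-long co) d≢c prd≢L ∷ [])
      shifted (Budget-shift (credit-shift {pr = pr} {pairFree pr c} d<c adjacent prd≢L) bud)
    where
    d<c = ≤∧≢⇒< (def≤c co) d≢c
    shifted = Core-shift co (suc d) (s≤s z≤n) (s≤s (<⇒≤ d<c)) (copies-shift w (defCopies co))
    adjacent : Adjacent (pr d) (pairFree pr c (suc d))
    adjacent = subst (λ x → Adjacent x (pairFree pr c (suc d))) (pairFree-< pr c d d<c)
      (PairedUpTo.adjacent (Core.prefixPaired (Core-free shifted)) d (1≤def co) (s≤s (<⇒≤ d<c)))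

  copyCase : ∀ {r c dn d l t p k pr} j → (∀ {r'} → r' < suc r → Loop r') → c + suc r ≡ n →
    Core c dn (fac d (suc (suc l)) ∷ t) p k pr → Budget c dn (fac d (suc (suc l)) ∷ t) pr → d ≢ c → pr d ≡ L →
    HaltsWithin (5 * suc r + 1) (st loop (suc c) j p k pr)
  copyCase {r} {c} j ih e co bud d≢c prd =
    Steps-then (loop→stepA (Core-<n co) ∷ stepA-copy (pocz-factor co) (kon-long co) d≢c prd ∷ steps)
      (afterCut r' (λ r''≤r' → ih (≤-<-trans r''≤r' r'<1+r)) j' e' core budget endsR)
      (subst₂ (λ a b → 2 + (suc (suc a) + suc cuts) + (5 * r' + 2) ≤ 5 * b + 1) cuts+l* (sym split)
              (time-copy cuts l* r' cuts≤2))
    where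
    d<c = ≤∧≢⇒< (def≤c co) d≢c
    module Copy = CopyPhase co prd d<c
    open Copy.Outcome (Copy.copyAndCut bud)
    r' = proj₁ (m≤n⇒∃[o]m+o≡n (Core-≤n core))
    e' = proj₂ (m≤n⇒∃[o]m+o≡n (Core-≤n core))
    split : suc r ≡ suc (suc l*) + r'
    split = +-cancelˡ-≡ c _ _ (trans e (trans (sym e') (+-assoc c _ r')))
    r'<1+r : r' < suc r
    r'<1+r = subst (r' <_) (sym split) (s≤s (m≤n+m r' (suc l*)))

  loopStep : ∀ r → (∀ {r'} → r' < r → Loop r') → Loop r
  loopStep zero _ {c} {rest = []} j e co bud = halt j (trans (sym (+-identityʳ c)) e) co bud
  loopStep zero _ {c} {rest = _ ∷ _} j e co _ = ⊥-elim (<⇒≢ (Core-<n co) (trans (sym (+-identityʳ c)) e))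
  loopStep (suc r) _ {c} {rest = []} j e co _ = ⊥-elim (<⇒≢ (m<m+n c (s≤s z≤n)) (trans (endRest co) (sym e)))
  loopStep (suc r) ih {rest = free ∷ t} j e co bud =
    viaFree j (ih (n<1+n r)) e (loop→stepA (Core-<n co) ∷ stepA-free (pocz-free co) ∷ []) co (Budget-free bud)
  loopStep (suc r) ih {rest = fac d zero ∷ t} j e co bud with validRest co
  ... | () , _
  loopStep (suc r) ih {rest = fac d 1 ∷ t} j e co bud =
    viaFree j (ih (n<1+n r)) e (loop→stepA (Core-<n co) ∷ stepA-unit (pocz-factor co) (kon-unit co) ∷ [])
      (Core-unitFactor co) (Budget-unit bud)
  loopStep (suc r) ih {c} {rest = fac d (suc (suc l)) ∷ t} {pr = pr} j e co bud with d ≟ c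
  ... | yes refl =
    viaFree j (ih (n<1+n r)) e (loop→stepA (Core-<n co) ∷ stepA-selfOverlap (pocz-factor co) (kon-long co) ∷ [])
      (Core-shift co c (Core.1≤c co) (n≤1+n c) (copies-selfOverlap w (defCopies co)))
      (Budget-shift (credit-selfOverlap c pr (pairFree pr c)) bud)
  ... | no d≢c with pr d ≟L
  ...   | yes prd   = copyCase j ih e co bud d≢c prd
  ...   | no prd≢L = shiftCase j (ih (n<1+n r)) e co bud d≢c prd≢L

  mainLoop : ∀ r → Loop r
  mainLoop = <-rec Loop loopStep


pairing-halts : ∀ {A : Set} (w : List A) fs → IsLZ77 w fs →
                MainLoop.HaltsWithin w fs (5 * suc (length w)) (initSt fs)
pairing-halts [] [] _ =
  MainLoop.halts (st done 2 0 (poczOf []) (konOf []) (λ _ → N)) refl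
    ([] , refl , (λ { (suc _) _ () }) ,
     ((λ { (suc _) _ () }) , (λ _ _ ()) , (λ { (suc _) _ () })) ,
     (λ _ _ ()) , (λ _ _ _ ()) , (λ _ _ _ ()) , z≤n , z≤n)
pairing-halts [] (free ∷ t) v = ⊥-elim (<-irrefl (sym (ValidFrom⇒endFrom [] 1 t v)) (≤-endFrom 1 t))
pairing-halts w (fac d len ∷ t) (_ , 1≤d , d≤0 , _) = ⊥-elim (<-irrefl refl (≤-trans 1≤d d≤0))
pairing-halts (x ∷ w') (free ∷ t) v =
  HaltsWithin-mono (subst (5 * length w' + 1 ≤_) (time (length w')) (m≤m+n _ 9))
                   (mainLoop (length w') 0 refl core₀ budget₀)
  where
  open MainLoop (x ∷ w') (free ∷ t)
  open Invariant (x ∷ w') (free ∷ t)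
  core₀ : Core 1 (free ∷ []) t (poczOf (free ∷ t)) (konOf (free ∷ t)) (λ _ → N)
  core₀ = record
    { endDone = refl ; 1≤c = ≤-refl ; valid = v ; poczOK = λ _ → refl ; konOK = λ _ → refl
    ; prefixPaired  = record { startNotR = λ ()
                             ; adjacent  = λ q 1≤q q<1 → ⊥-elim (<-irrefl refl (≤-trans q<1 1≤q)) }
    ; lastNotL      = λ ()
    ; factorsPaired = []
    ; fewFactors    = ≤-refl
    }
  budget₀ : Budget 1 (free ∷ []) t (λ _ → N)
  budget₀ = record { bound = s≤s (+-monoʳ-≤ (nFree t) (credits≤ 1 (λ _ → N) t)) }
  time : ∀ m → 5 * m + 1 + 9 ≡ 5 * suc (suc m)
  time = solve-∀

lemma1 : Σ ℕ λ c → ∀ {A : Set} (w : List A) (fs : List Piece) → IsLZ77 w fs →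
    Σ St λ s → (run (length w) (c * suc (length w)) (initSt fs) ≡ just s) ×
    (Σ (List Piece) λ fs' →
    IsLZ77 w fs' × Stores (length w) fs' (St.pocz s) (St.kon s) ×
    IsPairing (length w) (St.pair s) ×
    P1 (length w) (St.pair s) × P2 fs' (St.pair s) × P3 fs' (St.pair s) ×
    (nFree fs' ≤ nFree fs + 6 * nFactors fs) × (nFactors fs' ≤ nFactors fs))
lemma1 = 5 , λ w fs v → case pairing-halts w fs v of λ { (MainLoop.halts s runs goal) → s , runs , goal }
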